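{- Let $N,\mu$ be integers with $1\le N<\mu$ and let $n\ge0$ be an integer. Then \[ \sum_{p = 1}^n ( - 1)^{p - 1} \sum_{\nu = 1}^N \frac{\mu }{\nu ^{n - p + 1} (\mu - \nu )^p } =H_{N,n} - ( - 1)^n \left[ H_{\mu - 1,n} - H_{\mu - N - 1,n} \right]. \] In particular, \[ \sum_{\nu = 1}^N \frac{\mu }{\nu (\mu - \nu )} = H_N + H_{\mu - 1} - H_{\mu - N - 1}. \]
   Context: For integers $m\ge0$ and $n$, $H_{m,n}=\sum_{k=1}^m k^{ -n}$ (with $H_{0,n}=0$), and $H_m=H_{m,1}$. -}

module Defs where

open import Data.Nat as ℕ using (ℕ; zero; suc)
open import Data.Integer using (+_)
open import Data.Rational using (ℚ; 0ℚ; 1ℚ; _/_; _+_; _*_; -_)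

-- reciprocal of a natural number as a rational; only ever applied to
-- positive arguments in the statement (the value at 0 is irrelevant)
recip : ℕ → ℚ
recip zero    = 0ℚ
recip (suc d) = + 1 / suc d

Σ[1…_] : ℕ → (ℕ → ℚ) → ℚ
Σ[1… zero  ] f = 0ℚ
Σ[1… suc m ] f = Σ[1… m ] f + f (suc m)

sign : ℕ → ℚ
sign zero    = 1ℚ
sign (suc k) = - sign k

H : ℕ → ℕ → ℚ
H m n = Σ[1… m ] (λ k → recip (k ℕ.^ n))

module Submission where

-- For 1 ≤ ν < μ put x = 1/ν and y = 1/(μ-ν).  Partial fractions give
--   μ x y = x + y,                                                      (1)
-- and any x, y, M with M x y = x + y satisfy the alternating telescoping identity
--   Σ_{p=1}^n (-1)^{p-1} M x^{n-p+1} y^p = x^n - (-1)^n y^n,            (2)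
-- by induction on n: the sum for n+1 is x times the sum for n plus the last
-- term (-1)^n M x y^{n+1} = (-1)^n (x + y) y^n.
-- Summing (2) over ν = 1..N (after exchanging the two finite sums) yields
--   H_{N,n} - (-1)^n Σ_{ν=1}^N (μ-ν)^{-n},
-- and the reflection ν ↦ μ-ν identifies the last sum with H_{μ-1,n} - H_{μ-N-1,n}.

open import Defs
open import Data.Nat as ℕ using (ℕ; zero; suc; _≤_; _<_; _∸_; z≤n; s≤s)
import Data.Nat.Properties as ℕP
open import Data.Integer as ℤ using (+_; 1ℤ)
import Data.Integer.Properties as ℤP
open import Data.Rational using (ℚ; 0ℚ; 1ℚ; _+_; _-_; _*_; -_; _/_; toℚᵘ; fromℚᵘ; +-*-rawSemiring)
import Data.Rational.Properties as ℚP
open ℚP using (toℚᵘ-injective; toℚᵘ-fromℚᵘ; toℚᵘ-homo-+; toℚᵘ-homo-*; fromℚᵘ-cong)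
open import Data.Rational.Solver using (module +-*-Solver)
import Data.Rational.Unnormalised as ℚᵘ
import Data.Rational.Unnormalised.Properties as ℚᵘP
open import Algebra.Definitions.RawSemiring +-*-rawSemiring using (_^_)
open import Data.Product using (_×_; _,_)
open import Relation.Binary.PropositionalEquality

open +-*-Solver using (solve; _:+_; _:*_; :-_; _:=_; con)

-- Both the cast  + a / 1  and  recip (suc d)  are fromℚᵘ of an unnormalised
-- rational, so their arithmetic can be done without gcd computations.
fromℚᵘ-homo-+ : ∀ p q → fromℚᵘ (p ℚᵘ.+ q) ≡ fromℚᵘ p + fromℚᵘ q
fromℚᵘ-homo-+ p q = toℚᵘ-injective (begin
  toℚᵘ (fromℚᵘ (p ℚᵘ.+ q))               ≈⟨ toℚᵘ-fromℚᵘ (p ℚᵘ.+ q) ⟩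
  p ℚᵘ.+ q                                ≈⟨ ℚᵘP.+-cong (toℚᵘ-fromℚᵘ p) (toℚᵘ-fromℚᵘ q) ⟨
  toℚᵘ (fromℚᵘ p) ℚᵘ.+ toℚᵘ (fromℚᵘ q)    ≈⟨ toℚᵘ-homo-+ (fromℚᵘ p) (fromℚᵘ q) ⟨
  toℚᵘ (fromℚᵘ p + fromℚᵘ q)              ∎)
  where open ℚᵘP.≃-Reasoning

fromℚᵘ-homo-* : ∀ p q → fromℚᵘ (p ℚᵘ.* q) ≡ fromℚᵘ p * fromℚᵘ q
fromℚᵘ-homo-* p q = toℚᵘ-injective (begin
  toℚᵘ (fromℚᵘ (p ℚᵘ.* q))               ≈⟨ toℚᵘ-fromℚᵘ (p ℚᵘ.* q) ⟩
  p ℚᵘ.* q                                ≈⟨ ℚᵘP.*-cong (toℚᵘ-fromℚᵘ p) (toℚᵘ-fromℚᵘ q) ⟨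
  toℚᵘ (fromℚᵘ p) ℚᵘ.* toℚᵘ (fromℚᵘ q)    ≈⟨ toℚᵘ-homo-* (fromℚᵘ p) (fromℚᵘ q) ⟨
  toℚᵘ (fromℚᵘ p * fromℚᵘ q)              ∎)
  where open ℚᵘP.≃-Reasoning

ℕ→ℚᵘ : ℕ → ℚᵘ.ℚᵘ
ℕ→ℚᵘ a = ℚᵘ.mkℚᵘ (+ a) 0

cast-+ : ∀ a b → + (a ℕ.+ b) / 1 ≡ + a / 1 + + b / 1
cast-+ a b = trans (fromℚᵘ-cong {ℕ→ℚᵘ (a ℕ.+ b)} {ℕ→ℚᵘ a ℚᵘ.+ ℕ→ℚᵘ b} (ℚᵘ.*≡* cross))
                   (fromℚᵘ-homo-+ (ℕ→ℚᵘ a) (ℕ→ℚᵘ b))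
  where
  open ≡-Reasoning
  cross : + (a ℕ.+ b) ℤ.* 1ℤ ≡ (+ a ℤ.* 1ℤ ℤ.+ + b ℤ.* 1ℤ) ℤ.* 1ℤ
  cross = begin
    + (a ℕ.+ b) ℤ.* 1ℤ                  ≡⟨ ℤP.*-identityʳ _ ⟩
    + (a ℕ.+ b)                         ≡⟨ ℤP.pos-+ a b ⟩
    + a ℤ.+ + b                         ≡⟨ cong₂ ℤ._+_ (ℤP.*-identityʳ (+ a)) (ℤP.*-identityʳ (+ b)) ⟨
    + a ℤ.* 1ℤ ℤ.+ + b ℤ.* 1ℤ           ≡⟨ ℤP.*-identityʳ _ ⟨
    (+ a ℤ.* 1ℤ ℤ.+ + b ℤ.* 1ℤ) ℤ.* 1ℤ  ∎

cast-*-recip : ∀ d → + suc d / 1 * recip (suc d) ≡ 1ℚ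
cast-*-recip d = trans (sym (fromℚᵘ-homo-* (ℕ→ℚᵘ (suc d)) (ℚᵘ.mkℚᵘ (+ 1) d)))
                       (fromℚᵘ-cong (ℚᵘP.*-inverseʳ (ℕ→ℚᵘ (suc d))))

-- recip is multiplicative (also at 0, where it is 0)
recip-* : ∀ a b → recip (a ℕ.* b) ≡ recip a * recip b
recip-* zero    b       = sym (ℚP.*-zeroˡ (recip b))
recip-* (suc a) zero    = trans (cong recip (ℕP.*-zeroʳ a)) (sym (ℚP.*-zeroʳ (recip (suc a))))
recip-* (suc a) (suc b) = fromℚᵘ-homo-* (ℚᵘ.mkℚᵘ (+ 1) a) (ℚᵘ.mkℚᵘ (+ 1) b)

recip-^ : ∀ a m → recip (a ℕ.^ m) ≡ recip a ^ m
recip-^ a zero    = refl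
recip-^ a (suc m) = trans (recip-* a (a ℕ.^ m)) (cong (recip a *_) (recip-^ a m))

partial-fractions : ∀ A B x y → A * x ≡ 1ℚ → B * y ≡ 1ℚ → (A + B) * x * y ≡ x + y
partial-fractions A B x y Ax≡1 By≡1 = begin
  (A + B) * x * y           ≡⟨ solve 4 (λ A B x y → (A :+ B) :* x :* y := (A :* x) :* y :+ (B :* y) :* x)
                                       refl A B x y ⟩
  (A * x) * y + (B * y) * x ≡⟨ cong₂ (λ u v → u * y + v * x) Ax≡1 By≡1 ⟩
  1ℚ * y + 1ℚ * x           ≡⟨ solve 2 (λ x y → con 1ℚ :* y :+ con 1ℚ :* x := x :+ y) refl x y ⟩
  x + y                     ∎
  where open ≡-Reasoning

μ-split : ∀ ν μ → 1 ≤ ν → ν < μ → + μ / 1 * recip ν * recip (μ ∸ ν) ≡ recip ν + recip (μ ∸ ν)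
μ-split ν μ 1≤ν ν<μ = subst (λ m → + m / 1 * recip ν * recip (μ ∸ ν) ≡ recip ν + recip (μ ∸ ν))
  (ℕP.m+[n∸m]≡n (ℕP.<⇒≤ ν<μ)) (sum-split ν (μ ∸ ν) 1≤ν (ℕP.m<n⇒0<n∸m ν<μ))
  where
  sum-split : ∀ a c → 1 ≤ a → 1 ≤ c → + (a ℕ.+ c) / 1 * recip a * recip c ≡ recip a + recip c
  sum-split (suc a) (suc c) _ _ =
    trans (cong (λ u → u * recip (suc a) * recip (suc c)) (cast-+ (suc a) (suc c)))
          (partial-fractions (+ suc a / 1) (+ suc c / 1) (recip (suc a)) (recip (suc c))
                             (cast-*-recip a) (cast-*-recip c))

Σ-cong : ∀ m {f g : ℕ → ℚ} → (∀ j → 1 ≤ j → j ≤ m → f j ≡ g j) → Σ[1… m ] f ≡ Σ[1… m ] g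
Σ-cong zero    f≗g = refl
Σ-cong (suc m) f≗g = cong₂ _+_ (Σ-cong m (λ j 1≤j j≤m → f≗g j 1≤j (ℕP.m≤n⇒m≤1+n j≤m)))
                                (f≗g (suc m) (s≤s z≤n) ℕP.≤-refl)

Σ-zero : ∀ m → Σ[1… m ] (λ _ → 0ℚ) ≡ 0ℚ
Σ-zero zero    = refl
Σ-zero (suc m) = trans (ℚP.+-identityʳ _) (Σ-zero m)

Σ-+ : ∀ m (f g : ℕ → ℚ) → Σ[1… m ] (λ j → f j + g j) ≡ Σ[1… m ] f + Σ[1… m ] g
Σ-+ zero    f g = refl
Σ-+ (suc m) f g = trans (cong (_+ (f (suc m) + g (suc m))) (Σ-+ m f g))
  (solve 4 (λ a b c d → (a :+ b) :+ (c :+ d) := (a :+ c) :+ (b :+ d)) refl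
         (Σ[1… m ] f) (Σ[1… m ] g) (f (suc m)) (g (suc m)))

Σ-*ˡ : ∀ m c (f : ℕ → ℚ) → Σ[1… m ] (λ j → c * f j) ≡ c * Σ[1… m ] f
Σ-*ˡ zero    c f = sym (ℚP.*-zeroʳ c)
Σ-*ˡ (suc m) c f = trans (cong (_+ (c * f (suc m))) (Σ-*ˡ m c f)) (sym (ℚP.*-distribˡ-+ c _ _))

Σ-neg : ∀ m (f : ℕ → ℚ) → Σ[1… m ] (λ j → - f j) ≡ - Σ[1… m ] f
Σ-neg zero    f = refl
Σ-neg (suc m) f = trans (cong (_+ (- f (suc m))) (Σ-neg m f)) (sym (ℚP.neg-distrib-+ (Σ[1… m ] f) (f (suc m))))

Σ-swap : ∀ n N (F : ℕ → ℕ → ℚ) →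
  Σ[1… n ] (λ p → Σ[1… N ] (F p)) ≡ Σ[1… N ] (λ ν → Σ[1… n ] (λ p → F p ν))
Σ-swap zero    N F = sym (Σ-zero N)
Σ-swap (suc n) N F = trans (cong (_+ Σ[1… N ] (F (suc n))) (Σ-swap n N F))
  (sym (Σ-+ N (λ ν → Σ[1… n ] (λ p → F p ν)) (F (suc n))))

Σ-reflect : ∀ (g : ℕ → ℚ) N μ → N < μ →
  Σ[1… N ] (λ ν → g (μ ∸ ν)) ≡ Σ[1… μ ∸ 1 ] g - Σ[1… μ ∸ N ∸ 1 ] g
Σ-reflect g zero    μ _   = sym (ℚP.+-inverseʳ (Σ[1… μ ∸ 1 ] g))
Σ-reflect g (suc N) μ N<μ = begin
  Σ[1… N ] (λ ν → g (μ ∸ ν)) + g (μ ∸ suc N)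
    ≡⟨ cong (_+ g (μ ∸ suc N)) (Σ-reflect g N μ (ℕP.<⇒≤ N<μ)) ⟩
  Σ[1… μ ∸ 1 ] g - Σ[1… μ ∸ N ∸ 1 ] g + g (μ ∸ suc N)
    ≡⟨ cong (λ k → Σ[1… μ ∸ 1 ] g - Σ[1… k ] g + g (μ ∸ suc N)) μ∸N∸1≡μ∸[1+N] ⟩
  Σ[1… μ ∸ 1 ] g - Σ[1… μ ∸ suc N ] g + g (μ ∸ suc N)
    ≡⟨ drop-last (Σ[1… μ ∸ 1 ] g) (μ ∸ suc N) (ℕP.m<n⇒0<n∸m N<μ) ⟩
  Σ[1… μ ∸ 1 ] g - Σ[1… μ ∸ suc N ∸ 1 ] g
    ∎
  where
  open ≡-Reasoning
  μ∸N∸1≡μ∸[1+N] : μ ∸ N ∸ 1 ≡ μ ∸ suc N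
  μ∸N∸1≡μ∸[1+N] = trans (ℕP.∸-+-assoc μ N 1) (cong (μ ∸_) (ℕP.+-comm N 1))
  drop-last : ∀ a k → 1 ≤ k → a - Σ[1… k ] g + g k ≡ a - Σ[1… k ∸ 1 ] g
  drop-last a (suc k) _ = solve 3 (λ a s t → a :+ (:- (s :+ t)) :+ t := a :+ (:- s)) refl
                                  a (Σ[1… k ] g) (g (suc k))

alternating-telescope : ∀ M x y → M * x * y ≡ x + y → ∀ n →
  Σ[1… n ] (λ p → sign (p ∸ 1) * (M * x ^ ((n ∸ p) ℕ.+ 1) * y ^ p)) ≡ x ^ n - sign n * y ^ n
alternating-telescope M x y Mxy≡x+y = telescope
  where
  open ≡-Reasoning

  term : ℕ → ℕ → ℚ
  term n p = sign (p ∸ 1) * (M * x ^ ((n ∸ p) ℕ.+ 1) * y ^ p)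

  term-suc : ∀ n p → p ≤ n → term (suc n) p ≡ x * term n p
  term-suc n p p≤n rewrite ℕP.+-∸-assoc 1 p≤n =
    solve 5 (λ s M x X Y → s :* (M :* (x :* X) :* Y) := x :* (s :* (M :* X :* Y))) refl
          (sign (p ∸ 1)) M x (x ^ ((n ∸ p) ℕ.+ 1)) (y ^ p)

  -- the new last term is where the hypothesis M x y = x + y enters
  term-last : ∀ n → term (suc n) (suc n) ≡ sign n * ((x + y) * y ^ n)
  term-last n = begin
    sign n * (M * x ^ ((n ∸ n) ℕ.+ 1) * (y * y ^ n))
      ≡⟨ cong (λ k → sign n * (M * x ^ (k ℕ.+ 1) * (y * y ^ n))) (ℕP.n∸n≡0 n) ⟩
    sign n * (M * (x * 1ℚ) * (y * y ^ n))
      ≡⟨ solve 5 (λ s M x y Y → s :* (M :* (x :* con 1ℚ) :* (y :* Y)) := s :* ((M :* x :* y) :* Y)) refl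
               (sign n) M x y (y ^ n) ⟩
    sign n * ((M * x * y) * y ^ n)
      ≡⟨ cong (λ u → sign n * (u * y ^ n)) Mxy≡x+y ⟩
    sign n * ((x + y) * y ^ n)
      ∎

  telescope : ∀ n → Σ[1… n ] (term n) ≡ x ^ n - sign n * y ^ n
  telescope zero    = refl
  telescope (suc n) = begin
    Σ[1… n ] (term (suc n)) + term (suc n) (suc n)
      ≡⟨ cong₂ _+_ (Σ-cong n (λ p _ p≤n → term-suc n p p≤n)) (term-last n) ⟩
    Σ[1… n ] (λ p → x * term n p) + sign n * ((x + y) * y ^ n)
      ≡⟨ cong (_+ sign n * ((x + y) * y ^ n)) (trans (Σ-*ˡ n x (term n)) (cong (x *_) (telescope n))) ⟩
    x * (x ^ n - sign n * y ^ n) + sign n * ((x + y) * y ^ n)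
      ≡⟨ solve 5 (λ x y s X Y → x :* (X :+ (:- (s :* Y))) :+ s :* ((x :+ y) :* Y)
                                := x :* X :+ (:- ((:- s) :* (y :* Y)))) refl
               x y (sign n) (x ^ n) (y ^ n) ⟩
    x * x ^ n - (- sign n) * (y * y ^ n)
      ∎

inner-sum : ∀ μ n ν → 1 ≤ ν → ν < μ →
  Σ[1… n ] (λ p → sign (p ∸ 1) * (+ μ / 1 * recip (ν ℕ.^ ((n ∸ p) ℕ.+ 1)) * recip ((μ ∸ ν) ℕ.^ p)))
    ≡ recip (ν ℕ.^ n) - sign n * recip ((μ ∸ ν) ℕ.^ n)
inner-sum μ n ν 1≤ν ν<μ = begin
  Σ[1… n ] (λ p → sign (p ∸ 1) * (+ μ / 1 * recip (ν ℕ.^ ((n ∸ p) ℕ.+ 1)) * recip ((μ ∸ ν) ℕ.^ p)))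
    ≡⟨ Σ-cong n (λ p _ _ → cong₂ (λ u v → sign (p ∸ 1) * (+ μ / 1 * u * v))
                                  (recip-^ ν ((n ∸ p) ℕ.+ 1)) (recip-^ (μ ∸ ν) p)) ⟩
  Σ[1… n ] (λ p → sign (p ∸ 1) * (+ μ / 1 * recip ν ^ ((n ∸ p) ℕ.+ 1) * recip (μ ∸ ν) ^ p))
    ≡⟨ alternating-telescope (+ μ / 1) (recip ν) (recip (μ ∸ ν)) (μ-split ν μ 1≤ν ν<μ) n ⟩
  recip ν ^ n - sign n * recip (μ ∸ ν) ^ n
    ≡⟨ cong₂ (λ u v → u - sign n * v) (recip-^ ν n) (recip-^ (μ ∸ ν) n) ⟨
  recip (ν ℕ.^ n) - sign n * recip ((μ ∸ ν) ℕ.^ n)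
    ∎
  where open ≡-Reasoning

alternating-double-sum : ∀ N μ n → N < μ →
  Σ[1… n ] (λ p → sign (p ∸ 1) * Σ[1… N ] (λ ν → (+ μ / 1) * recip (ν ℕ.^ ((n ∸ p) ℕ.+ 1)) * recip ((μ ∸ ν) ℕ.^ p)))
    ≡ H N n - sign n * (H (μ ∸ 1) n - H (μ ∸ N ∸ 1) n)
alternating-double-sum N μ n N<μ = begin
  Σ[1… n ] (λ p → sign (p ∸ 1) * Σ[1… N ] (G p))
    ≡⟨ Σ-cong n (λ p _ _ → Σ-*ˡ N (sign (p ∸ 1)) (G p)) ⟨
  Σ[1… n ] (λ p → Σ[1… N ] (λ ν → sign (p ∸ 1) * G p ν))
    ≡⟨ Σ-swap n N (λ p ν → sign (p ∸ 1) * G p ν) ⟩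
  Σ[1… N ] (λ ν → Σ[1… n ] (λ p → sign (p ∸ 1) * G p ν))
    ≡⟨ Σ-cong N (λ ν 1≤ν ν≤N → inner-sum μ n ν 1≤ν (ℕP.≤-<-trans ν≤N N<μ)) ⟩
  Σ[1… N ] (λ ν → recip (ν ℕ.^ n) - sign n * recip ((μ ∸ ν) ℕ.^ n))
    ≡⟨ Σ-+ N (λ ν → recip (ν ℕ.^ n)) (λ ν → - (sign n * recip ((μ ∸ ν) ℕ.^ n))) ⟩
  H N n + Σ[1… N ] (λ ν → - (sign n * recip ((μ ∸ ν) ℕ.^ n)))
    ≡⟨ cong (λ s → H N n + s) (Σ-neg N (λ ν → sign n * recip ((μ ∸ ν) ℕ.^ n))) ⟩
  H N n - Σ[1… N ] (λ ν → sign n * recip ((μ ∸ ν) ℕ.^ n))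
    ≡⟨ cong (λ s → H N n - s) (Σ-*ˡ N (sign n) (λ ν → recip ((μ ∸ ν) ℕ.^ n))) ⟩
  H N n - sign n * Σ[1… N ] (λ ν → recip ((μ ∸ ν) ℕ.^ n))
    ≡⟨ cong (λ s → H N n - sign n * s) (Σ-reflect (λ k → recip (k ℕ.^ n)) N μ N<μ) ⟩
  H N n - sign n * (H (μ ∸ 1) n - H (μ ∸ N ∸ 1) n)
    ∎
  where
  open ≡-Reasoning
  G : ℕ → ℕ → ℚ
  G p ν = (+ μ / 1) * recip (ν ℕ.^ ((n ∸ p) ℕ.+ 1)) * recip ((μ ∸ ν) ℕ.^ p)

reciprocal-product-sum : ∀ N μ → N < μ →
  Σ[1… N ] (λ ν → (+ μ / 1) * recip ν * recip (μ ∸ ν)) ≡ H N 1 + H (μ ∸ 1) 1 - H (μ ∸ N ∸ 1) 1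
reciprocal-product-sum N μ N<μ = begin
  Σ[1… N ] (λ ν → (+ μ / 1) * recip ν * recip (μ ∸ ν))
    ≡⟨ Σ-cong N (λ ν _ _ → cong₂ (λ a b → (+ μ / 1) * recip a * recip b)
                                 (sym (ℕP.*-identityʳ ν)) (sym (ℕP.*-identityʳ (μ ∸ ν)))) ⟩
  S
    ≡⟨ solve 1 (λ s → s := con 0ℚ :+ con 1ℚ :* s) refl S ⟩
  0ℚ + 1ℚ * S
    ≡⟨ alternating-double-sum N μ 1 N<μ ⟩
  H N 1 - sign 1 * (H (μ ∸ 1) 1 - H (μ ∸ N ∸ 1) 1)
    ≡⟨ solve 3 (λ h a b → h :+ (:- ((:- con 1ℚ) :* (a :+ (:- b)))) := h :+ a :+ (:- b)) refl
             (H N 1) (H (μ ∸ 1) 1) (H (μ ∸ N ∸ 1) 1) ⟩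
  H N 1 + H (μ ∸ 1) 1 - H (μ ∸ N ∸ 1) 1
    ∎
  where
  open ≡-Reasoning
  S : ℚ
  S = Σ[1… N ] (λ ν → (+ μ / 1) * recip (ν ℕ.^ 1) * recip ((μ ∸ ν) ℕ.^ 1))

-- Theorem 2.3
theorem2p3 : (N μ n : ℕ) → 1 ≤ N → N < μ →
    (Σ[1… n ] (λ p → sign (p ∸ 1) * Σ[1… N ] (λ ν → (+ μ / 1) * recip (ν ℕ.^ ((n ∸ p) ℕ.+ 1)) * recip ((μ ∸ ν) ℕ.^ p)))
      ≡ H N n - sign n * (H (μ ∸ 1) n - H (μ ∸ N ∸ 1) n))
    × (Σ[1… N ] (λ ν → (+ μ / 1) * recip ν * recip (μ ∸ ν))
      ≡ H N 1 + H (μ ∸ 1) 1 - H (μ ∸ N ∸ 1) 1)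
theorem2p3 N μ n _ N<μ = alternating-double-sum N μ n N<μ , reciprocal-product-sum N μ N<μ
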